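{- Let $m\ge 1$ and let $u_0,\dots,u_{m-1},v_0,\dots,v_{m-1}$ be complex numbers with $1+u_iv_j\neq 0$ for all $i,j\in\{0,\dots,m-1\}$. Let $M_m(\vec u,\vec v)$ be the $m\times m$ matrix with entries $\frac{u_i+v_j}{1+u_iv_j}$, $0\le i,j\le m-1$. Then $$\det M_m(\vec u,\vec v)=\frac12\Bigl(\prod_{i=0}^{m-1}(1+u_i)\prod_{j=0}^{m-1}(1+v_j)+(-1)^m\prod_{i=0}^{m-1}(1-u_i)\prod_{j=0}^{m-1}(1-v_j)\Bigr)\prod_{0\le i<j\le m-1}(u_i-u_j)\prod_{0\le i<j\le m-1}(v_j-v_i)\prod_{i=0}^{m-1}\prod_{j=0}^{m-1}(1+u_iv_j)^{ -1}.$$ -}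

module Defs where

open import Level using (_⊔_) renaming (suc to lsuc)
open import Data.Nat using (ℕ; zero; suc)
open import Data.Fin using (Fin; zero; suc; toℕ; punchIn; _<?_)
open import Relation.Nullary using (¬_; yes; no)
open import Algebra.Bundles using (CommutativeRing)

record Field c ℓ : Set (lsuc (c ⊔ ℓ)) where
  field
    commutativeRing : CommutativeRing c ℓ
  open CommutativeRing commutativeRing public
  field
    inv      : (x : Carrier) → ¬ (x ≈ 0#) → Carrier
    inverse  : ∀ x (p : ¬ (x ≈ 0#)) → (x * inv x p) ≈ 1#
    0≉1      : ¬ (0# ≈ 1#)

module FieldOps {c ℓ} (F : Field c ℓ) where
  open Field F using (Carrier; _+_; _*_; -_; 0#; 1#)

  ∑ : (n : ℕ) → (Fin n → Carrier) → Carrier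
  ∑ zero    f = 0#
  ∑ (suc n) f = f zero + ∑ n (λ i → f (suc i))

  ∏ : (n : ℕ) → (Fin n → Carrier) → Carrier
  ∏ zero    f = 1#
  ∏ (suc n) f = f zero * ∏ n (λ i → f (suc i))

  sgn : ℕ → Carrier
  sgn zero    = 1#
  sgn (suc k) = - 1# * sgn k

  ∏< : (n : ℕ) → (Fin n → Fin n → Carrier) → Carrier
  ∏< n f = ∏ n (λ i → ∏ n (λ j → pick i j))
    where
    pick : Fin n → Fin n → Carrier
    pick i j with i <? j
    ... | yes _ = f i j
    ... | no  _ = 1#

  det : (n : ℕ) → (Fin n → Fin n → Carrier) → Carrier
  det zero    A = 1#
  det (suc n) A =
    ∑ (suc n) (λ j → sgn (toℕ j) * (A zero j * det n (λ i k → A (suc i) (punchIn j k))))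

{-# OPTIONS --safe #-}
module Submission where

-- Write w i j = (1 + u i v j)⁻¹ and J for the all-ones matrix. The determinant is affine along
-- rank-one perturbations, so det M is the average of det (M + J) and det (M − J). Entrywise
-- M + J = diag (1 + u) · w · diag (1 + v) and M − J = − diag (1 − u) · w · diag (1 − v), which
-- reduces everything to the Cauchy-type determinant
--   det w = ∏_{i<j} (u i − u j) (v j − v i) · ∏_{i,j} w i j.
-- That one is computed by induction: subtracting the first row from the others and then the
-- first column from the others makes every entry factor, since
--   a x − b y = (a q − b p) x y   whenever p x = q y = 1,
-- and what remains is the same matrix built from the tails of u and v.

open import Algebra.Bundles using (CommutativeRing; RawRing)
open import Algebra.Solver.Ring.AlmostCommutativeRing
  using (fromCommutativeRing; _-Raw-AlmostCommutative⟶_)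
open import Data.Empty using (⊥-elim)
open import Data.Fin using (Fin; zero; suc; toℕ; punchIn; lift; _<?_)
open import Data.Integer.Base as ℤ using (ℤ; +_; -[1+_]; _⊖_; sign; ∣_∣; _◃_)
import Data.Integer.Properties as ℤ
open import Data.Maybe.Base using (Maybe; map)
open import Data.Nat.Base as ℕ using (ℕ; zero; suc; _≤_)
import Data.Nat.Properties as ℕ
open import Data.Sign.Base as Sign using (Sign)
open import Data.Vec.Functional using (_∷_; tail; removeAt; updateAt)
open import Data.Vec.Functional.Properties using (map-updateAt)
open import Function.Base using (_∘_; const)
open import Relation.Binary.Consequences using (dec⇒weaklyDec)
open import Relation.Binary.PropositionalEquality as ≡ using (_≡_)
open import Relation.Nullary using (¬_; Dec; yes; no)

open import Defs

-- The ring solver over an arbitrary commutative ring with integer coefficients: deciding equality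
-- of coefficients is what lets normalisation cancel terms such as x - x.
module ℤ-RingSolver {c ℓ} (R : CommutativeRing c ℓ) where
  open CommutativeRing R
  open import Algebra.Properties.Ring ring using (-‿involutive; -0#≈0#; -‿distribˡ-*; -‿+-comm; -1*x≈-x)
  open import Algebra.Properties.Semiring.Mult.TCOptimised semiring using (_×_; 1+×; ×-homo-+; ×1-homo-*)
  open import Relation.Binary.Reasoning.Setoid setoid

  fromℤ : ℤ → Carrier
  fromℤ (+ n)    = n × 1#
  fromℤ -[1+ n ] = - (suc n × 1#)

  fromSign : Sign → Carrier
  fromSign Sign.+ = 1#
  fromSign Sign.- = - 1#

  fromℤ-homo-⊖ : ∀ m n → fromℤ (m ⊖ n) ≈ m × 1# - n × 1#
  fromℤ-homo-⊖ m       zero    = sym (trans (+-congˡ -0#≈0#) (+-identityʳ _))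
  fromℤ-homo-⊖ zero    (suc n) = sym (+-identityˡ _)
  fromℤ-homo-⊖ (suc m) (suc n) = begin
    fromℤ (suc m ⊖ suc n)    ≡⟨ ≡.cong fromℤ (ℤ.[1+m]⊖[1+n]≡m⊖n m n) ⟩
    fromℤ (m ⊖ n)            ≈⟨ fromℤ-homo-⊖ m n ⟩
    a - b                    ≈⟨ +-identityˡ (a - b) ⟨
    0# + (a - b)             ≈⟨ +-congʳ (-‿inverseʳ 1#) ⟨
    (1# - 1#) + (a - b)      ≈⟨ interchange 1# (- 1#) a (- b) ⟩
    (1# + a) + (- 1# - b)    ≈⟨ +-congˡ (-‿+-comm 1# b) ⟩
    (1# + a) - (1# + b)      ≈⟨ +-cong (1+× m 1#) (-‿cong (1+× n 1#)) ⟨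
    suc m × 1# - suc n × 1#  ∎
    where
    open import Algebra.Properties.CommutativeSemigroup +-commutativeSemigroup using (interchange)
    a = m × 1#
    b = n × 1#

  fromℤ-homo-+ : ∀ i j → fromℤ (i ℤ.+ j) ≈ fromℤ i + fromℤ j
  fromℤ-homo-+ (+ m)    (+ n)    = ×-homo-+ 1# m n
  fromℤ-homo-+ (+ m)    -[1+ n ] = fromℤ-homo-⊖ m (suc n)
  fromℤ-homo-+ -[1+ m ] (+ n)    = trans (fromℤ-homo-⊖ n (suc m)) (+-comm _ _)
  fromℤ-homo-+ -[1+ m ] -[1+ n ] = begin
    - (suc (suc (m ℕ.+ n)) × 1#)  ≡⟨ ≡.cong (λ k → - (suc k × 1#)) (ℕ.+-suc m n) ⟨
    - ((suc m ℕ.+ suc n) × 1#)    ≈⟨ -‿cong (×-homo-+ 1# (suc m) (suc n)) ⟩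
    - (suc m × 1# + suc n × 1#)   ≈⟨ -‿+-comm _ _ ⟨
    - (suc m × 1#) - suc n × 1#   ∎

  fromℤ-homo-- : ∀ i → fromℤ (ℤ.- i) ≈ - fromℤ i
  fromℤ-homo-- (+ zero)  = sym -0#≈0#
  fromℤ-homo-- (+ suc n) = refl
  fromℤ-homo-- -[1+ n ]  = sym (-‿involutive _)

  fromℤ-homo-◃ : ∀ s n → fromℤ (s ◃ n) ≈ fromSign s * n × 1#
  fromℤ-homo-◃ s      zero    = sym (zeroʳ _)
  fromℤ-homo-◃ Sign.+ (suc n) = sym (*-identityˡ _)
  fromℤ-homo-◃ Sign.- (suc n) = trans (-‿cong (sym (*-identityˡ _))) (-‿distribˡ-* _ _)

  fromSign-homo-* : ∀ s t → fromSign (s Sign.* t) ≈ fromSign s * fromSign t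
  fromSign-homo-* Sign.+ t      = sym (*-identityˡ _)
  fromSign-homo-* Sign.- Sign.+ = sym (*-identityʳ _)
  fromSign-homo-* Sign.- Sign.- = sym (trans (-1*x≈-x (- 1#)) (-‿involutive 1#))

  fromℤ-sign-abs : ∀ i → fromℤ i ≈ fromSign (sign i) * ∣ i ∣ × 1#
  fromℤ-sign-abs i =
    trans (reflexive (≡.cong fromℤ (≡.sym (ℤ.◃-inverse i)))) (fromℤ-homo-◃ (sign i) ∣ i ∣)

  fromℤ-homo-* : ∀ i j → fromℤ (i ℤ.* j) ≈ fromℤ i * fromℤ j
  fromℤ-homo-* i j = begin
    fromℤ ((sign i Sign.* sign j) ◃ (∣ i ∣ ℕ.* ∣ j ∣))
      ≈⟨ fromℤ-homo-◃ _ (∣ i ∣ ℕ.* ∣ j ∣) ⟩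
    fromSign (sign i Sign.* sign j) * (∣ i ∣ ℕ.* ∣ j ∣) × 1#
      ≈⟨ *-cong (fromSign-homo-* (sign i) (sign j)) (×1-homo-* ∣ i ∣ ∣ j ∣) ⟩
    (s * t) * (a * b)
      ≈⟨ interchange s t a b ⟩
    (s * a) * (t * b)
      ≈⟨ *-cong (fromℤ-sign-abs i) (fromℤ-sign-abs j) ⟨
    fromℤ i * fromℤ j ∎
    where
    open import Algebra.Properties.CommutativeSemigroup *-commutativeSemigroup using (interchange)
    s = fromSign (sign i)
    t = fromSign (sign j)
    a = ∣ i ∣ × 1#
    b = ∣ j ∣ × 1#

  private
    ℤ-rawRing : RawRing _ _
    ℤ-rawRing = record
      { Carrier = ℤ ; _≈_ = _≡_ ; _+_ = ℤ._+_ ; _*_ = ℤ._*_ ; -_ = ℤ.-_ ; 0# = + 0 ; 1# = + 1 }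

    homomorphism : ℤ-rawRing -Raw-AlmostCommutative⟶ fromCommutativeRing R
    homomorphism = record
      { ⟦_⟧ = fromℤ ; +-homo = fromℤ-homo-+ ; *-homo = fromℤ-homo-* ; -‿homo = fromℤ-homo--
      ; 0-homo = refl ; 1-homo = refl }

    fromℤ-equal? : ∀ i j → Maybe (fromℤ i ≈ fromℤ j)
    fromℤ-equal? i j = map (λ { ≡.refl → refl }) (dec⇒weaklyDec ℤ._≟_ i j)

  open import Algebra.Solver.Ring ℤ-rawRing (fromCommutativeRing R) homomorphism fromℤ-equal? public

module Determinant {c ℓ} (F : Field c ℓ) where
  open Field F hiding (zero)
  open FieldOps F
  open ℤ-RingSolver commutativeRing using (solve; _:+_; _:*_; _:-_; :-_; _:=_; con)
  open import Algebra.Properties.Ring ring using (-0#≈0#; -‿+-comm)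
  open import Relation.Binary.Reasoning.Setoid setoid

  Matrix : ℕ → Set c
  Matrix n = Fin n → Fin n → Carrier

  ∑-cong : ∀ n {f g : Fin n → Carrier} → (∀ i → f i ≈ g i) → ∑ n f ≈ ∑ n g
  ∑-cong zero    f≈g = refl
  ∑-cong (suc n) f≈g = +-cong (f≈g zero) (∑-cong n (f≈g ∘ suc))

  ∏-cong : ∀ n {f g : Fin n → Carrier} → (∀ i → f i ≈ g i) → ∏ n f ≈ ∏ n g
  ∏-cong zero    f≈g = refl
  ∏-cong (suc n) f≈g = *-cong (f≈g zero) (∏-cong n (f≈g ∘ suc))

  ∑-zero : ∀ n {f : Fin n → Carrier} → (∀ i → f i ≈ 0#) → ∑ n f ≈ 0#
  ∑-zero zero    f≈0 = refl
  ∑-zero (suc n) f≈0 = trans (+-cong (f≈0 zero) (∑-zero n (f≈0 ∘ suc))) (+-identityˡ 0#)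

  ∑-distrib-+ : ∀ n (f g : Fin n → Carrier) → ∑ n (λ i → f i + g i) ≈ ∑ n f + ∑ n g
  ∑-distrib-+ zero    f g = sym (+-identityˡ 0#)
  ∑-distrib-+ (suc n) f g = trans (+-congˡ (∑-distrib-+ n (f ∘ suc) (g ∘ suc))) (interchange _ _ _ _)
    where
    interchange : ∀ a b x y → (a + b) + (x + y) ≈ (a + x) + (b + y)
    interchange = solve 4 (λ a b x y → (a :+ b) :+ (x :+ y) := (a :+ x) :+ (b :+ y)) refl

  *-distribˡ-∑ : ∀ n x (f : Fin n → Carrier) → x * ∑ n f ≈ ∑ n (λ i → x * f i)
  *-distribˡ-∑ zero    x f = zeroʳ x
  *-distribˡ-∑ (suc n) x f = trans (distribˡ x _ _) (+-congˡ (*-distribˡ-∑ n x (f ∘ suc)))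

  -‿distrib-∑ : ∀ n (f : Fin n → Carrier) → - ∑ n f ≈ ∑ n (λ i → - f i)
  -‿distrib-∑ zero    f = -0#≈0#
  -‿distrib-∑ (suc n) f = trans (sym (-‿+-comm _ _)) (+-congˡ (-‿distrib-∑ n (f ∘ suc)))

  ∑-comm : ∀ m n (f : Fin m → Fin n → Carrier) →
           ∑ m (λ i → ∑ n (f i)) ≈ ∑ n (λ j → ∑ m (λ i → f i j))
  ∑-comm zero    n f = sym (∑-zero n (λ _ → refl))
  ∑-comm (suc m) n f = trans (+-congˡ (∑-comm m n (f ∘ suc))) (sym (∑-distrib-+ n (f zero) _))

  ∏-distrib-* : ∀ n (f g : Fin n → Carrier) → ∏ n (λ i → f i * g i) ≈ ∏ n f * ∏ n g
  ∏-distrib-* zero    f g = sym (*-identityˡ 1#)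
  ∏-distrib-* (suc n) f g = trans (*-congˡ (∏-distrib-* n (f ∘ suc) (g ∘ suc))) (interchange _ _ _ _)
    where
    interchange : ∀ a b x y → (a * b) * (x * y) ≈ (a * x) * (b * y)
    interchange = solve 4 (λ a b x y → (a :* b) :* (x :* y) := (a :* x) :* (b :* y)) refl

  ∏-neg : ∀ n (f : Fin n → Carrier) → ∏ n (λ i → - f i) ≈ sgn n * ∏ n f
  ∏-neg zero    f = sym (*-identityˡ 1#)
  ∏-neg (suc n) f = trans (*-congˡ (∏-neg n (f ∘ suc))) (pull-sign _ _ _)
    where
    pull-sign : ∀ a s p → - a * (s * p) ≈ (- 1# * s) * (a * p)
    pull-sign = solve 3 (λ a s p → :- a :* (s :* p) := (:- con (+ 1) :* s) :* (a :* p)) refl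

  -- det (suc n) A unfolds to expand (suc n) (A zero) (λ j → det n (dropColumn (tail A) j)).
  expand : ∀ n → (Fin n → Carrier) → (Fin n → Carrier) → Carrier
  expand n x d = ∑ n (λ j → sgn (toℕ j) * (x j * d j))

  dropColumn : ∀ {m n} → (Fin m → Fin (suc n) → Carrier) → Fin (suc n) → Fin m → Fin n → Carrier
  dropColumn Y j i = removeAt (Y i) j

  expand-cong : ∀ n {x y d e : Fin n → Carrier} → (∀ j → x j ≈ y j) → (∀ j → d j ≈ e j) →
                expand n x d ≈ expand n y e
  expand-cong n x≈y d≈e = ∑-cong n (λ j → *-congˡ (*-cong (x≈y j) (d≈e j)))

  expand-congʳ : ∀ n (x : Fin n → Carrier) {d e : Fin n → Carrier} → (∀ j → d j ≈ e j) →
                 expand n x d ≈ expand n x e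
  expand-congʳ n x = expand-cong n (λ _ → refl)

  expand-suc : ∀ n (x d : Fin (suc n) → Carrier) →
               expand (suc n) x d ≈ x zero * d zero - expand n (x ∘ suc) (d ∘ suc)
  expand-suc n x d = begin
    1# * (x zero * d zero) + ∑ n (λ j → (- 1# * sgn (toℕ j)) * (x (suc j) * d (suc j)))
      ≈⟨ +-cong (*-identityˡ _) (∑-cong n (λ j → neg-first _ _)) ⟩
    x zero * d zero + ∑ n (λ j → - (sgn (toℕ j) * (x (suc j) * d (suc j))))
      ≈⟨ +-congˡ (-‿distrib-∑ n _) ⟨
    x zero * d zero - expand n (x ∘ suc) (d ∘ suc) ∎
    where
    neg-first : ∀ s t → (- 1# * s) * t ≈ - (s * t)
    neg-first = solve 2 (λ s t → (:- con (+ 1) :* s) :* t := :- (s :* t)) refl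

  expand-zeroˡ : ∀ n {x : Fin n → Carrier} (d : Fin n → Carrier) → (∀ j → x j ≈ 0#) → expand n x d ≈ 0#
  expand-zeroˡ n d x≈0 = ∑-zero n (λ j → trans (*-congˡ (trans (*-congʳ (x≈0 j)) (zeroˡ _))) (zeroʳ _))

  expand-zeroʳ : ∀ n (x : Fin n → Carrier) {d : Fin n → Carrier} → (∀ j → d j ≈ 0#) → expand n x d ≈ 0#
  expand-zeroʳ n x d≈0 = ∑-zero n (λ j → trans (*-congˡ (trans (*-congˡ (d≈0 j)) (zeroʳ _))) (zeroʳ _))

  expand-*ˡ : ∀ n a (x d : Fin n → Carrier) → expand n (λ j → a * x j) d ≈ a * expand n x d
  expand-*ˡ n a x d = trans (∑-cong n (λ j → pull _ _ _ _)) (sym (*-distribˡ-∑ n a _))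
    where
    pull : ∀ s a x d → s * ((a * x) * d) ≈ a * (s * (x * d))
    pull = solve 4 (λ s a x d → s :* ((a :* x) :* d) := a :* (s :* (x :* d))) refl

  expand-*ʳ : ∀ n a (x d : Fin n → Carrier) → expand n x (λ j → a * d j) ≈ a * expand n x d
  expand-*ʳ n a x d = trans (∑-cong n (λ j → pull _ _ _ _)) (sym (*-distribˡ-∑ n a _))
    where
    pull : ∀ s x a d → s * (x * (a * d)) ≈ a * (s * (x * d))
    pull = solve 4 (λ s x a d → s :* (x :* (a :* d)) := a :* (s :* (x :* d))) refl

  expand-+ˡ : ∀ n (x y d : Fin n → Carrier) → expand n (λ j → x j + y j) d ≈ expand n x d + expand n y d
  expand-+ˡ n x y d = trans (∑-cong n (λ j → spread _ _ _ _)) (∑-distrib-+ n _ _)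
    where
    spread : ∀ s x y d → s * ((x + y) * d) ≈ s * (x * d) + s * (y * d)
    spread = solve 4 (λ s x y d → s :* ((x :+ y) :* d) := s :* (x :* d) :+ s :* (y :* d)) refl

  expand-+ʳ : ∀ n (x d e : Fin n → Carrier) → expand n x (λ j → d j + e j) ≈ expand n x d + expand n x e
  expand-+ʳ n x d e = trans (∑-cong n (λ j → spread _ _ _ _)) (∑-distrib-+ n _ _)
    where
    spread : ∀ s x d e → s * (x * (d + e)) ≈ s * (x * d) + s * (x * e)
    spread = solve 4 (λ s x d e → s :* (x :* (d :+ e)) := s :* (x :* d) :+ s :* (x :* e)) refl

  expand-negʳ : ∀ n (x d : Fin n → Carrier) → expand n x (λ j → - d j) ≈ - expand n x d
  expand-negʳ n x d = trans (∑-cong n (λ j → pull _ _ _)) (sym (-‿distrib-∑ n _))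
    where
    pull : ∀ s x d → s * (x * - d) ≈ - (s * (x * d))
    pull = solve 3 (λ s x d → s :* (x :* :- d) := :- (s :* (x :* d))) refl

  expand-∑ʳ : ∀ n m (x : Fin n → Carrier) (f : Fin m → Fin n → Carrier) →
              expand n x (λ j → ∑ m (λ r → f r j)) ≈ ∑ m (λ r → expand n x (f r))
  expand-∑ʳ n m x f = trans (∑-cong n pull) (∑-comm n m _)
    where
    pull : ∀ j → sgn (toℕ j) * (x j * ∑ m (λ r → f r j)) ≈ ∑ m (λ r → sgn (toℕ j) * (x j * f r j))
    pull j = trans (*-congˡ (*-distribˡ-∑ m (x j) _)) (*-distribˡ-∑ m (sgn (toℕ j)) _)

  expand-comm : ∀ m n (x : Fin m → Carrier) (y : Fin n → Carrier) (T : Fin n → Fin m → Carrier) →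
                expand m x (λ j → expand n y (λ i → T i j)) ≈ expand n y (λ i → expand m x (T i))
  expand-comm m n x y T = begin
    expand m x (λ j → expand n y (λ i → T i j))
      ≈⟨ expand-∑ʳ m n x (λ i j → sgn (toℕ i) * (y i * T i j)) ⟩
    ∑ n (λ i → expand m x (λ j → sgn (toℕ i) * (y i * T i j)))
      ≈⟨ ∑-cong n (λ i → trans (expand-*ʳ m _ x _) (*-congˡ (expand-*ʳ m (y i) x (T i)))) ⟩
    expand n y (λ i → expand m x (T i)) ∎

  det-cong : ∀ n {A B : Matrix n} → (∀ i j → A i j ≈ B i j) → det n A ≈ det n B
  det-cong zero    A≈B = refl
  det-cong (suc n) A≈B =
    expand-cong (suc n) (A≈B zero) (λ j → det-cong n (λ i k → A≈B (suc i) (punchIn j k)))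

  det-cong-rows : ∀ n {A B : Matrix n} → (∀ i → A i ≡ B i) → det n A ≈ det n B
  det-cong-rows n A≡B = det-cong n (λ i j → reflexive (≡.cong-app (A≡B i) j))

  -- Without function extensionality, G has to be assumed to respect pointwise equal column
  -- selections.
  Extensional : ∀ {m n} → ((Fin m → Fin n) → Carrier) → Set ℓ
  Extensional G = ∀ σ τ → (∀ l → σ l ≡ τ l) → G σ ≈ G τ

  Extensional-lift : ∀ {m n} {G : (Fin (suc m) → Fin (suc n)) → Carrier} →
                     Extensional G → Extensional (G ∘ lift 1)
  Extensional-lift G-ext σ τ σ≗τ =
    G-ext (lift 1 σ) (lift 1 τ) λ { zero → ≡.refl ; (suc l) → ≡.cong suc (σ≗τ l) }

  -- Laplace expansion along two rows a and b: det (a ∷ b ∷ Y) unfolds to expand₂ n a b G where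
  -- G σ is the determinant of Y restricted to the columns σ.
  expand₂ : ∀ N (a b : Fin (suc (suc N)) → Carrier) → ((Fin N → Fin (suc (suc N))) → Carrier) → Carrier
  expand₂ N a b G =
    expand (suc (suc N)) a (λ j → expand (suc N) (removeAt b j) (λ k → G (punchIn j ∘ punchIn k)))

  expandTail : ∀ N (x : Fin (suc (suc (suc N))) → Carrier) →
               ((Fin (suc N) → Fin (suc (suc (suc N)))) → Carrier) → Carrier
  expandTail N x G = expand (suc (suc N)) (x ∘ suc) (λ k → G (suc ∘ punchIn k))

  expand₂-zero : ∀ a b {G} → Extensional G →
                 expand₂ 0 a b G ≈ (a zero * b (suc zero) - a (suc zero) * b zero) * G (λ ())
  expand₂-zero a b {G} G-ext = begin
    expand₂ 0 a b G
      ≈⟨ collect _ _ _ _ _ _ ⟩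
    a zero * b (suc zero) * G _ - a (suc zero) * b zero * G _
      ≈⟨ +-cong (*-congˡ (G-ext _ _ λ ())) (-‿cong (*-congˡ (G-ext _ _ λ ()))) ⟩
    a zero * b (suc zero) * G (λ ()) - a (suc zero) * b zero * G (λ ())
      ≈⟨ factor _ _ _ ⟩
    (a zero * b (suc zero) - a (suc zero) * b zero) * G (λ ()) ∎
    where
    collect : ∀ a₀ a₁ b₀ b₁ x y →
      1# * (a₀ * (1# * (b₁ * x) + 0#)) + ((- 1# * 1#) * (a₁ * (1# * (b₀ * y) + 0#)) + 0#)
        ≈ a₀ * b₁ * x - a₁ * b₀ * y
    collect = solve 6 (λ a₀ a₁ b₀ b₁ x y →
      con (+ 1) :* (a₀ :* (con (+ 1) :* (b₁ :* x) :+ con (+ 0)))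
        :+ ((:- con (+ 1) :* con (+ 1)) :* (a₁ :* (con (+ 1) :* (b₀ :* y) :+ con (+ 0))) :+ con (+ 0))
      := a₀ :* b₁ :* x :- a₁ :* b₀ :* y) refl
    factor : ∀ p q x → p * x - q * x ≈ (p - q) * x
    factor = solve 3 (λ p q x → p :* x :- q :* x := (p :- q) :* x) refl

  expand₂-suc : ∀ N a b {G} → Extensional G →
    expand₂ (suc N) a b G
      ≈ a zero * expandTail N b G - (b zero * expandTail N a G - expand₂ N (a ∘ suc) (b ∘ suc) (G ∘ lift 1))
  expand₂-suc N a b {G} G-ext = begin
    expand₂ (suc N) a b G
      ≈⟨ expand-suc (suc (suc N)) a D ⟩
    a zero * expandTail N b G - expand (suc (suc N)) (a ∘ suc) (D ∘ suc)
      ≈⟨ +-congˡ (-‿cong (expand-congʳ _ (a ∘ suc) D-suc)) ⟩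
    a zero * expandTail N b G - expand (suc (suc N)) (a ∘ suc) (λ j → b zero * H j - I j)
      ≈⟨ +-congˡ (-‿cong (trans (expand-+ʳ _ (a ∘ suc) (λ j → b zero * H j) (λ j → - I j))
                                (+-cong (expand-*ʳ _ (b zero) (a ∘ suc) H) (expand-negʳ _ (a ∘ suc) I)))) ⟩
    a zero * expandTail N b G - (b zero * expandTail N a G - expand₂ N (a ∘ suc) (b ∘ suc) (G ∘ lift 1)) ∎
    where
    D : Fin (suc (suc (suc N))) → Carrier
    D j = expand (suc (suc N)) (removeAt b j) (λ k → G (punchIn j ∘ punchIn k))
    H I : Fin (suc (suc N)) → Carrier
    H j = G (suc ∘ punchIn j)
    I j = expand (suc N) (removeAt (b ∘ suc) j) (λ k → G (lift 1 (punchIn j ∘ punchIn k)))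
    D-suc : ∀ j → D (suc j) ≈ b zero * H j - I j
    D-suc j = trans (expand-suc (suc N) (removeAt b (suc j)) (λ k → G (punchIn (suc j) ∘ punchIn k)))
      (+-congˡ (-‿cong (expand-congʳ (suc N) (removeAt (b ∘ suc) j) λ k →
        G-ext (punchIn (suc j) ∘ punchIn (suc k)) (lift 1 (punchIn j ∘ punchIn k))
              λ { zero → ≡.refl ; (suc l) → ≡.refl })))

  expand₂-anti : ∀ N a b {G} → Extensional G → expand₂ N a b G ≈ - expand₂ N b a G
  expand₂-anti zero a b {G} G-ext = begin
    expand₂ 0 a b G                                                 ≈⟨ expand₂-zero a b G-ext ⟩
    (a zero * b (suc zero) - a (suc zero) * b zero) * G (λ ())      ≈⟨ swap-rows _ _ _ _ _ ⟩
    - ((b zero * a (suc zero) - b (suc zero) * a zero) * G (λ ()))  ≈⟨ -‿cong (expand₂-zero b a G-ext) ⟨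
    - expand₂ 0 b a G                                               ∎
    where
    swap-rows : ∀ a₀ a₁ b₀ b₁ x → (a₀ * b₁ - a₁ * b₀) * x ≈ - ((b₀ * a₁ - b₁ * a₀) * x)
    swap-rows = solve 5 (λ a₀ a₁ b₀ b₁ x →
      (a₀ :* b₁ :- a₁ :* b₀) :* x := :- ((b₀ :* a₁ :- b₁ :* a₀) :* x)) refl
  expand₂-anti (suc N) a b {G} G-ext = begin
    expand₂ (suc N) a b G
      ≈⟨ expand₂-suc N a b G-ext ⟩
    p - (q - expand₂ N a′ b′ G′)
      ≈⟨ +-congˡ (-‿cong (+-congˡ (-‿cong (expand₂-anti N a′ b′ G′-ext)))) ⟩
    p - (q - - expand₂ N b′ a′ G′)
      ≈⟨ swap-rows p q _ ⟩
    - (q - (p - expand₂ N b′ a′ G′))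
      ≈⟨ -‿cong (expand₂-suc N b a G-ext) ⟨
    - expand₂ (suc N) b a G ∎
    where
    p = a zero * expandTail N b G
    q = b zero * expandTail N a G
    a′ = a ∘ suc
    b′ = b ∘ suc
    G′ = G ∘ lift 1
    G′-ext = Extensional-lift G-ext
    swap-rows : ∀ p q d → p - (q - - d) ≈ - (q - (p - d))
    swap-rows = solve 3 (λ p q d → p :- (q :- :- d) := :- (q :- (p :- d))) refl

  expand₂-diag : ∀ N a {G} → Extensional G → expand₂ N a a G ≈ 0#
  expand₂-diag zero a G-ext = trans (expand₂-zero a a G-ext) (cancel _ _ _)
    where
    cancel : ∀ a₀ a₁ x → (a₀ * a₁ - a₁ * a₀) * x ≈ 0#
    cancel = solve 3 (λ a₀ a₁ x → (a₀ :* a₁ :- a₁ :* a₀) :* x := con (+ 0)) refl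
  expand₂-diag (suc N) a {G} G-ext = begin
    expand₂ (suc N) a a G
      ≈⟨ expand₂-suc N a a G-ext ⟩
    p - (p - expand₂ N a′ a′ G′)
      ≈⟨ +-congˡ (-‿cong (+-congˡ (-‿cong (expand₂-diag N a′ (Extensional-lift G-ext))))) ⟩
    p - (p - 0#)
      ≈⟨ cancel p ⟩
    0# ∎
    where
    p = a zero * expandTail N a G
    a′ = a ∘ suc
    G′ = G ∘ lift 1
    cancel : ∀ p → p - (p - 0#) ≈ 0#
    cancel = solve 1 (λ p → p :- (p :- con (+ 0)) := con (+ 0)) refl

  minors-extensional : ∀ n (Y : Fin n → Fin (suc (suc n)) → Carrier) →
                       Extensional (λ σ → det n (λ i l → Y i (σ l)))
  minors-extensional n Y σ τ σ≗τ = det-cong n (λ i l → reflexive (≡.cong (Y i) (σ≗τ l)))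

  det-swap : ∀ n (a b : Fin (suc (suc n)) → Carrier) Y →
             det (suc (suc n)) (a ∷ b ∷ Y) ≈ - det (suc (suc n)) (b ∷ a ∷ Y)
  det-swap n a b Y = expand₂-anti n a b (minors-extensional n Y)

  det-repeated-row₀₁ : ∀ n (a : Fin (suc (suc n)) → Carrier) Y → det (suc (suc n)) (a ∷ a ∷ Y) ≈ 0#
  det-repeated-row₀₁ n a Y = expand₂-diag n a (minors-extensional n Y)

  infixl 6 _[_]≔_
  _[_]≔_ : ∀ {n} {X : Set c} → (Fin n → X) → Fin n → X → Fin n → X
  xs [ r ]≔ x = updateAt xs r (const x)

  []≔-suc : ∀ {n} {X : Set c} (xs : Fin (suc n) → X) r x i →
            (xs [ suc r ]≔ x) i ≡ (xs zero ∷ tail xs [ r ]≔ x) i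
  []≔-suc xs r x zero    = ≡.refl
  []≔-suc xs r x (suc i) = ≡.refl

  dropColumn-[]≔ : ∀ {m n} (Y : Fin m → Fin (suc n) → Carrier) r z j i →
                   dropColumn (Y [ r ]≔ z) j i ≡ (dropColumn Y j [ r ]≔ removeAt z j) i
  dropColumn-[]≔ Y r z j = map-updateAt {f = λ row → removeAt row j} (λ _ → ≡.refl) Y r

  -- Swapping the first two rows puts the repeated row into the first row of every minor.
  det-repeated-row : ∀ {n} (r : Fin n) (x : Fin (suc n) → Carrier) Y → det (suc n) (x ∷ Y [ r ]≔ x) ≈ 0#
  det-repeated-row {suc n} zero x Y =
    trans (det-cong-rows (suc (suc n)) {x ∷ Y [ zero ]≔ x} {x ∷ x ∷ tail Y}
                         λ { zero → ≡.refl ; (suc zero) → ≡.refl ; (suc (suc i)) → ≡.refl })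
          (det-repeated-row₀₁ n x (tail Y))
  det-repeated-row {suc (suc n)} (suc r) x Y = begin
    det (3 ℕ.+ n) (x ∷ Y [ suc r ]≔ x)
      ≈⟨ det-cong-rows (3 ℕ.+ n) {x ∷ Y [ suc r ]≔ x} {x ∷ Y zero ∷ Z}
                       (λ { zero → ≡.refl ; (suc i) → []≔-suc Y r x i }) ⟩
    det (3 ℕ.+ n) (x ∷ Y zero ∷ Z)
      ≈⟨ det-swap (suc n) x (Y zero) Z ⟩
    - det (3 ℕ.+ n) (Y zero ∷ x ∷ Z)
      ≈⟨ -‿cong (expand-zeroʳ _ (Y zero) minor≈0) ⟩
    - 0#
      ≈⟨ -0#≈0# ⟩
    0# ∎
    where
    Z = tail Y [ r ]≔ x
    minor≈0 : ∀ j → det (suc (suc n)) (dropColumn (x ∷ Z) j) ≈ 0#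
    minor≈0 j = trans
      (det-cong-rows (suc (suc n)) {dropColumn (x ∷ Z) j} {removeAt x j ∷ dropColumn (tail Y) j [ r ]≔ removeAt x j}
                     λ { zero → ≡.refl ; (suc i) → dropColumn-[]≔ (tail Y) r x j i })
      (det-repeated-row r (removeAt x j) (dropColumn (tail Y) j))

  ∑-repeated-rows : ∀ n (x : Fin (suc n) → Carrier) Y (a : Fin n → Carrier) →
                    ∑ n (λ r → a r * det (suc n) (x ∷ Y [ r ]≔ x)) ≈ 0#
  ∑-repeated-rows n x Y a = ∑-zero n (λ r → trans (*-congˡ (det-repeated-row r x Y)) (zeroʳ (a r)))

  expand-updated-minors : ∀ n (x z : Fin (suc n) → Carrier) Y (a : Fin n → Carrier) →
    expand (suc n) x (λ j → det n (dropColumn Y j) + ∑ n (λ r → a r * det n (dropColumn Y j [ r ]≔ removeAt z j)))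
      ≈ det (suc n) (x ∷ Y) + ∑ n (λ r → a r * det (suc n) (x ∷ Y [ r ]≔ z))
  expand-updated-minors n x z Y a = begin
    expand (suc n) x (λ j → det n (dropColumn Y j) + ∑ n (λ r → a r * Q r j))
      ≈⟨ expand-+ʳ (suc n) x (λ j → det n (dropColumn Y j)) (λ j → ∑ n (λ r → a r * Q r j)) ⟩
    det (suc n) (x ∷ Y) + expand (suc n) x (λ j → ∑ n (λ r → a r * Q r j))
      ≈⟨ +-congˡ (expand-∑ʳ (suc n) n x (λ r j → a r * Q r j)) ⟩
    det (suc n) (x ∷ Y) + ∑ n (λ r → expand (suc n) x (λ j → a r * Q r j))
      ≈⟨ +-congˡ (∑-cong n λ r → trans (expand-*ʳ (suc n) (a r) x (Q r)) (*-congˡ (sym (replaced r)))) ⟩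
    det (suc n) (x ∷ Y) + ∑ n (λ r → a r * det (suc n) (x ∷ Y [ r ]≔ z)) ∎
    where
    Q : Fin n → Fin (suc n) → Carrier
    Q r j = det n (dropColumn Y j [ r ]≔ removeAt z j)
    replaced : ∀ r → det (suc n) (x ∷ Y [ r ]≔ z) ≈ expand (suc n) x (Q r)
    replaced r = expand-congʳ (suc n) x (λ j → det-cong-rows n (dropColumn-[]≔ Y r z j))

  det-rank-one-update : ∀ n (B : Matrix n) (a z : Fin n → Carrier) →
    det n (λ i j → B i j + a i * z j) ≈ det n B + ∑ n (λ r → a r * det n (B [ r ]≔ z))
  det-rank-one-update zero    B a z = sym (+-identityʳ 1#)
  det-rank-one-update (suc n) B a z = begin
    det (suc n) (λ i j → B i j + a i * z j)
      ≈⟨ expand-congʳ (suc n) (λ j → B zero j + a zero * z j)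
           (λ j → det-rank-one-update n (dropColumn (tail B) j) (a ∘ suc) (removeAt z j)) ⟩
    expand (suc n) (λ j → B zero j + a zero * z j) D
      ≈⟨ trans (expand-+ˡ (suc n) (B zero) (λ j → a zero * z j) D) (+-congˡ (expand-*ˡ (suc n) (a zero) z D)) ⟩
    expand (suc n) (B zero) D + a zero * expand (suc n) z D
      ≈⟨ +-cong (expand-updated-minors n (B zero) z (tail B) (a ∘ suc))
                (*-congˡ (expand-updated-minors n z z (tail B) (a ∘ suc))) ⟩
    (det (suc n) B + S) + a zero * (det (suc n) (B [ zero ]≔ z) + S′)
      ≈⟨ +-congˡ (*-congˡ (+-congˡ (∑-repeated-rows n z (tail B) (a ∘ suc)))) ⟩
    (det (suc n) B + S) + a zero * (det (suc n) (B [ zero ]≔ z) + 0#)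
      ≈⟨ regroup _ _ _ _ ⟩
    det (suc n) B + (a zero * det (suc n) (B [ zero ]≔ z) + S) ∎
    where
    D : Fin (suc n) → Carrier
    D j = det n (dropColumn (tail B) j) + ∑ n (λ r → a (suc r) * det n (dropColumn (tail B) j [ r ]≔ removeAt z j))
    S = ∑ n (λ r → a (suc r) * det (suc n) (B [ suc r ]≔ z))
    S′ = ∑ n (λ r → a (suc r) * det (suc n) (z ∷ tail B [ r ]≔ z))
    regroup : ∀ d s a e → (d + s) + a * (e + 0#) ≈ d + (a * e + s)
    regroup = solve 4 (λ d s a e → (d :+ s) :+ a :* (e :+ con (+ 0)) := d :+ (a :* e :+ s)) refl

  det-add-multiples-of-row₀ : ∀ n (x : Fin (suc n) → Carrier) Y (a : Fin n → Carrier) →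
    det (suc n) (x ∷ λ i j → Y i j + a i * x j) ≈ det (suc n) (x ∷ Y)
  det-add-multiples-of-row₀ n x Y a = begin
    det (suc n) (x ∷ λ i j → Y i j + a i * x j)
      ≈⟨ expand-congʳ (suc n) x (λ j → det-rank-one-update n (dropColumn Y j) a (removeAt x j)) ⟩
    expand (suc n) x (λ j → det n (dropColumn Y j) + ∑ n (λ r → a r * det n (dropColumn Y j [ r ]≔ removeAt x j)))
      ≈⟨ expand-updated-minors n x x Y a ⟩
    det (suc n) (x ∷ Y) + ∑ n (λ r → a r * det (suc n) (x ∷ Y [ r ]≔ x))
      ≈⟨ +-congˡ (∑-repeated-rows n x Y a) ⟩
    det (suc n) (x ∷ Y) + 0#
      ≈⟨ +-identityʳ _ ⟩
    det (suc n) (x ∷ Y) ∎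

  det-column-expansion : ∀ n (A : Matrix (suc n)) →
    det (suc n) A ≈ expand (suc n) (λ i → A i zero) (λ i → det n (λ r k → A (punchIn i r) (suc k)))
  det-column-expansion zero    A = refl
  det-column-expansion (suc n) A = begin
    det (suc (suc n)) A
      ≈⟨ expand-suc (suc n) (A zero) (λ j → det (suc n) (dropColumn (tail A) j)) ⟩
    A zero zero * det (suc n) A₁₁ - expand (suc n) (A zero ∘ suc) (λ j → det (suc n) (dropColumn (tail A) (suc j)))
      ≈⟨ +-congˡ (-‿cong (expand-congʳ (suc n) (A zero ∘ suc)
                            (λ j → det-column-expansion n (dropColumn (tail A) (suc j))))) ⟩
    A zero zero * det (suc n) A₁₁ - expand (suc n) (A zero ∘ suc) (λ j → expand (suc n) A₁₀ (λ i → T i j))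
      ≈⟨ +-congˡ (-‿cong (expand-comm (suc n) (suc n) (A zero ∘ suc) A₁₀ T)) ⟩
    A zero zero * det (suc n) A₁₁ - expand (suc n) A₁₀ (λ i → det (suc n) (minor (suc i)))
      ≈⟨ expand-suc (suc n) (λ i → A i zero) (λ i → det (suc n) (minor i)) ⟨
    expand (suc (suc n)) (λ i → A i zero) (λ i → det (suc n) (minor i)) ∎
    where
    A₁₁ : Matrix (suc n)
    A₁₁ i k = A (suc i) (suc k)
    A₁₀ : Fin (suc n) → Carrier
    A₁₀ i = A (suc i) zero
    minor : Fin (suc (suc n)) → Matrix (suc n)
    minor i r k = A (punchIn i r) (suc k)
    T : Fin (suc n) → Fin (suc n) → Carrier
    T i j = det n (λ r k → A (suc (punchIn i r)) (suc (punchIn j k)))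

  det-transpose : ∀ n (A : Matrix n) → det n (λ i j → A j i) ≈ det n A
  det-transpose zero    A = refl
  det-transpose (suc n) A = trans
    (expand-congʳ (suc n) (λ j → A j zero) (λ j → det-transpose n (λ r k → A (punchIn j r) (suc k))))
    (sym (det-column-expansion n A))

  det-scale-rows : ∀ n (α : Fin n → Carrier) (A : Matrix n) → det n (λ i j → α i * A i j) ≈ ∏ n α * det n A
  det-scale-rows zero    α A = sym (*-identityˡ 1#)
  det-scale-rows (suc n) α A = begin
    det (suc n) (λ i j → α i * A i j)
      ≈⟨ expand-congʳ (suc n) (λ j → α zero * A zero j) (λ j → det-scale-rows n (α ∘ suc) (minor j)) ⟩
    expand (suc n) (λ j → α zero * A zero j) (λ j → ∏ n (α ∘ suc) * det n (minor j))
      ≈⟨ expand-*ˡ (suc n) (α zero) (A zero) (λ j → ∏ n (α ∘ suc) * det n (minor j)) ⟩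
    α zero * expand (suc n) (A zero) (λ j → ∏ n (α ∘ suc) * det n (minor j))
      ≈⟨ *-congˡ (expand-*ʳ (suc n) (∏ n (α ∘ suc)) (A zero) (λ j → det n (minor j))) ⟩
    α zero * (∏ n (α ∘ suc) * det (suc n) A)
      ≈⟨ *-assoc _ _ _ ⟨
    ∏ (suc n) α * det (suc n) A ∎
    where
    minor = dropColumn (tail A)

  det-scale-columns : ∀ n (β : Fin n → Carrier) (A : Matrix n) → det n (λ i j → A i j * β j) ≈ ∏ n β * det n A
  det-scale-columns n β A = begin
    det n (λ i j → A i j * β j)    ≈⟨ det-transpose n (λ i j → A j i * β i) ⟩
    det n (λ i j → A j i * β i)    ≈⟨ det-cong n (λ i j → *-comm _ _) ⟩
    det n (λ i j → β i * A j i)    ≈⟨ det-scale-rows n β (λ i j → A j i) ⟩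
    ∏ n β * det n (λ i j → A j i)  ≈⟨ *-congˡ (det-transpose n A) ⟩
    ∏ n β * det n A                ∎

  det-scale : ∀ n (α β : Fin n → Carrier) (A : Matrix n) →
              det n (λ i j → α i * (A i j * β j)) ≈ ∏ n α * (∏ n β * det n A)
  det-scale n α β A = trans (det-scale-rows n α _) (*-congˡ (det-scale-columns n β A))

  det-add-multiples-of-column₀ : ∀ n (A : Matrix (suc n)) (a : Fin n → Carrier) →
    det (suc n) (λ i → A i zero ∷ λ k → A i (suc k) + a k * A i zero) ≈ det (suc n) A
  det-add-multiples-of-column₀ n A a = begin
    det (suc n) (λ i → A i zero ∷ λ k → A i (suc k) + a k * A i zero)
      ≈⟨ det-cong (suc n) {λ i → A i zero ∷ λ k → A i (suc k) + a k * A i zero} {λ i j → M j i}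
                  (λ { i zero → refl ; i (suc k) → refl }) ⟩
    det (suc n) (λ i j → M j i)  ≈⟨ det-transpose (suc n) M ⟩
    det (suc n) M                ≈⟨ det-add-multiples-of-row₀ n (Aᵀ zero) (tail Aᵀ) a ⟩
    det (suc n) Aᵀ               ≈⟨ det-transpose (suc n) A ⟩
    det (suc n) A                ∎
    where
    Aᵀ M : Matrix (suc n)
    Aᵀ i j = A j i
    M = Aᵀ zero ∷ λ k j → Aᵀ (suc k) j + a k * Aᵀ zero j

  det-sparse-row₀ : ∀ n (A : Matrix (suc n)) → (∀ k → A zero (suc k) ≈ 0#) →
                    det (suc n) A ≈ A zero zero * det n (λ i k → A (suc i) (suc k))
  det-sparse-row₀ n A row₀≈0 = begin
    det (suc n) A
      ≈⟨ expand-suc n (A zero) (λ j → det n (dropColumn (tail A) j)) ⟩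
    A zero zero * D - expand n (A zero ∘ suc) (λ k → det n (dropColumn (tail A) (suc k)))
      ≈⟨ +-congˡ (-‿cong (expand-zeroˡ n _ row₀≈0)) ⟩
    A zero zero * D - 0#
      ≈⟨ trans (+-congˡ -0#≈0#) (+-identityʳ _) ⟩
    A zero zero * D ∎
    where
    D = det n (λ i k → A (suc i) (suc k))

  select : ∀ {P : Set} → Carrier → Dec P → Carrier
  select x (yes _) = x
  select x (no _)  = 1#

  -- The helper inside ∏< cannot be referred to by name, so the type of pick≈select leaves it to
  -- unification with its use in ∏<-select.
  mutual
    ∏<-select : ∀ n (f : Fin n → Fin n → Carrier) → ∏< n f ≈ ∏ n (λ i → ∏ n (λ j → select (f i j) (i <? j)))
    ∏<-select n f = ∏-cong n (λ i → ∏-cong n (λ j → pick≈select n f i j))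

    pick≈select : ∀ n (f : Fin n → Fin n → Carrier) i j → _ ≈ select (f i j) (i <? j)
    pick≈select n f i j with i <? j
    ... | yes _ = refl
    ... | no  _ = refl

  select-suc : ∀ {n} (i j : Fin n) x → select x (suc i <? suc j) ≈ select x (i <? j)
  select-suc i j x with i <? j | suc i <? suc j
  ... | yes _   | yes _   = refl
  ... | no  _   | no  _   = refl
  ... | yes i<j | no  i≮j = ⊥-elim (i≮j (ℕ.s≤s i<j))
  ... | no  i≮j | yes i<j = ⊥-elim (i≮j (ℕ.s≤s⁻¹ i<j))

  ∏<-suc : ∀ n (f : Fin (suc n) → Fin (suc n) → Carrier) →
           ∏< (suc n) f ≈ ∏ n (λ j → f zero (suc j)) * ∏< n (λ i j → f (suc i) (suc j))
  ∏<-suc n f = begin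
    ∏< (suc n) f
      ≈⟨ ∏<-select (suc n) f ⟩
    (1# * ∏ n (λ j → f zero (suc j))) * ∏ n (λ i → 1# * ∏ n (λ j → select (f (suc i) (suc j)) (suc i <? suc j)))
      ≈⟨ *-cong (*-identityˡ _) (∏-cong n (λ i → trans (*-identityˡ _) (∏-cong n (λ j → select-suc i j _)))) ⟩
    ∏ n (λ j → f zero (suc j)) * ∏ n (λ i → ∏ n (λ j → select (f (suc i) (suc j)) (i <? j)))
      ≈⟨ *-congˡ (∏<-select n (λ i j → f (suc i) (suc j))) ⟨
    ∏ n (λ j → f zero (suc j)) * ∏< n (λ i j → f (suc i) (suc j)) ∎

  cross-difference : ∀ {p q x y} a b → p * x ≈ 1# → q * y ≈ 1# → a * x - b * y ≈ (a * q - b * p) * (x * y)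
  cross-difference {p} {q} {x} {y} a b px≈1 qy≈1 = begin
    a * x - b * y                          ≈⟨ +-cong (times-one (a * x) qy≈1) (-‿cong (times-one (b * y) px≈1)) ⟨
    (a * x) * (q * y) - (b * y) * (p * x)  ≈⟨ regroup a b p q x y ⟩
    (a * q - b * p) * (x * y)              ∎
    where
    times-one : ∀ z {e} → e ≈ 1# → z * e ≈ z
    times-one z e≈1 = trans (*-congˡ e≈1) (*-identityʳ z)
    regroup : ∀ a b p q x y → (a * x) * (q * y) - (b * y) * (p * x) ≈ (a * q - b * p) * (x * y)
    regroup = solve 6 (λ a b p q x y →
      (a :* x) :* (q :* y) :- (b :* y) :* (p :* x) := (a :* q :- b :* p) :* (x :* y)) refl

  cauchyMatrix : ∀ {n} (u v : Fin n → Carrier) → (∀ i j → ¬ ((1# + u i * v j) ≈ 0#)) → Matrix n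
  cauchyMatrix u v h i j = inv (1# + u i * v j) (h i j)

  cauchy-step : ∀ n (u v : Fin (suc n) → Carrier) h → let w = cauchyMatrix u v h in
    det (suc n) w ≈ ∏ n (λ i → u zero - u (suc i))
                      * (∏ (suc n) (w zero)
                        * (∏ n (λ i → w (suc i) zero)
                          * (∏ n (λ k → v (suc k) - v zero) * det n (λ i k → w (suc i) (suc k)))))
  cauchy-step n u v h = begin
    det (suc n) w
      ≈⟨ det-add-multiples-of-row₀ n (w zero) (tail w) (λ _ → - 1#) ⟨
    det (suc n) (w zero ∷ λ i j → w (suc i) j + - 1# * w zero j)
      ≈⟨ det-cong (suc n) {w zero ∷ λ i j → w (suc i) j + - 1# * w zero j} {λ i j → α i * (P i j * w zero j)}
                  (λ { zero j → sym (trans (*-identityˡ _) (*-identityˡ _)) ; (suc i) j → row-entry i j }) ⟩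
    det (suc n) (λ i j → α i * (P i j * w zero j))
      ≈⟨ det-scale (suc n) α (w zero) P ⟩
    (1# * Δu) * (W₀ * det (suc n) P)
      ≈⟨ *-congˡ (*-congˡ (det-add-multiples-of-column₀ n P (λ _ → - 1#))) ⟨
    (1# * Δu) * (W₀ * det (suc n) Q)
      ≈⟨ *-congˡ (*-congˡ (det-sparse-row₀ n Q (λ _ → cancel))) ⟩
    (1# * Δu) * (W₀ * (1# * det n (λ i k → v (suc k) * w (suc i) (suc k) + - 1# * (v zero * w (suc i) zero))))
      ≈⟨ *-congˡ (*-congˡ (*-congˡ (trans (det-cong n column-entry)
                                          (det-scale n (λ i → w (suc i) zero) Δv′ w′)))) ⟩
    (1# * Δu) * (W₀ * (1# * (Wc * (∏ n Δv′ * det n w′))))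
      ≈⟨ drop-ones _ _ _ _ _ ⟩
    Δu * (W₀ * (Wc * (∏ n Δv′ * det n w′))) ∎
    where
    w = cauchyMatrix u v h
    w′ : Matrix n
    w′ i k = w (suc i) (suc k)
    Δu = ∏ n (λ i → u zero - u (suc i))
    Δv′ : Fin n → Carrier
    Δv′ k = v (suc k) - v zero
    W₀ = ∏ (suc n) (w zero)
    Wc = ∏ n (λ i → w (suc i) zero)
    α : Fin (suc n) → Carrier
    α = 1# ∷ λ i → u zero - u (suc i)
    P Q : Matrix (suc n)
    P = (λ _ → 1#) ∷ λ i j → v j * w (suc i) j
    Q i = P i zero ∷ λ k → P i (suc k) + - 1# * P i zero
    w-inverse : ∀ i j → (1# + u i * v j) * w i j ≈ 1#
    w-inverse i j = inverse _ (h i j)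
    cancel : 1# + - 1# * 1# ≈ 0#
    cancel = solve 0 (con (+ 1) :+ :- con (+ 1) :* con (+ 1) := con (+ 0)) refl
    row-entry : ∀ i j → w (suc i) j + - 1# * w zero j ≈ (u zero - u (suc i)) * ((v j * w (suc i) j) * w zero j)
    row-entry i j = trans (one-times _ _)
      (trans (cross-difference 1# 1# (w-inverse (suc i) j) (w-inverse zero j)) (regroup _ _ _ _ _))
      where
      one-times : ∀ x y → x + - 1# * y ≈ 1# * x - 1# * y
      one-times = solve 2 (λ x y → x :+ :- con (+ 1) :* y := con (+ 1) :* x :- con (+ 1) :* y) refl
      regroup : ∀ u₀ uᵢ v x y → (1# * (1# + u₀ * v) - 1# * (1# + uᵢ * v)) * (x * y) ≈ (u₀ - uᵢ) * ((v * x) * y)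
      regroup = solve 5 (λ u₀ uᵢ v x y →
        (con (+ 1) :* (con (+ 1) :+ u₀ :* v) :- con (+ 1) :* (con (+ 1) :+ uᵢ :* v)) :* (x :* y)
          := (u₀ :- uᵢ) :* ((v :* x) :* y)) refl
    column-entry : ∀ i k → v (suc k) * w (suc i) (suc k) + - 1# * (v zero * w (suc i) zero)
                             ≈ w (suc i) zero * (w′ i k * Δv′ k)
    column-entry i k = trans (minus _ _)
      (trans (cross-difference (v (suc k)) (v zero) (w-inverse (suc i) (suc k)) (w-inverse (suc i) zero))
             (regroup _ _ _ _ _))
      where
      minus : ∀ x y → x + - 1# * y ≈ x - y
      minus = solve 2 (λ x y → x :+ :- con (+ 1) :* y := x :- y) refl
      regroup : ∀ uᵢ vₖ v₀ x y → (vₖ * (1# + uᵢ * v₀) - v₀ * (1# + uᵢ * vₖ)) * (x * y) ≈ y * (x * (vₖ - v₀))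
      regroup = solve 5 (λ uᵢ vₖ v₀ x y →
        (vₖ :* (con (+ 1) :+ uᵢ :* v₀) :- v₀ :* (con (+ 1) :+ uᵢ :* vₖ)) :* (x :* y) := y :* (x :* (vₖ :- v₀))) refl
    drop-ones : ∀ a b c d e → (1# * a) * (b * (1# * (c * (d * e)))) ≈ a * (b * (c * (d * e)))
    drop-ones = solve 5 (λ a b c d e →
      (con (+ 1) :* a) :* (b :* (con (+ 1) :* (c :* (d :* e)))) := a :* (b :* (c :* (d :* e)))) refl

  cauchy-det : ∀ n (u v : Fin n → Carrier) h → let w = cauchyMatrix u v h in
    det n w ≈ (∏< n (λ i j → u i - u j) * ∏< n (λ i j → v j - v i)) * ∏ n (λ i → ∏ n (w i))
  cauchy-det zero    u v h = sym (trans (*-identityʳ _) (*-identityʳ _))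
  cauchy-det (suc n) u v h = begin
    det (suc n) w
      ≈⟨ cauchy-step n u v h ⟩
    Δu * (W₀ * (Wc * (Δv * det n (λ i k → w (suc i) (suc k)))))
      ≈⟨ *-congˡ (*-congˡ (*-congˡ (*-congˡ (cauchy-det n (u ∘ suc) (v ∘ suc) (λ i j → h (suc i) (suc j)))))) ⟩
    Δu * (W₀ * (Wc * (Δv * ((Lu * Lv) * W′))))
      ≈⟨ regroup Δu W₀ Wc Δv Lu Lv W′ ⟩
    ((Δu * Lu) * (Δv * Lv)) * (W₀ * (Wc * W′))
      ≈⟨ *-cong (*-cong (∏<-suc n (λ i j → u i - u j)) (∏<-suc n (λ i j → v j - v i)))
                (*-congˡ (∏-distrib-* n (λ i → w (suc i) zero) (λ i → ∏ n (λ j → w (suc i) (suc j))))) ⟨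
    (∏< (suc n) (λ i j → u i - u j) * ∏< (suc n) (λ i j → v j - v i)) * ∏ (suc n) (λ i → ∏ (suc n) (w i)) ∎
    where
    w = cauchyMatrix u v h
    Δu = ∏ n (λ i → u zero - u (suc i))
    Δv = ∏ n (λ k → v (suc k) - v zero)
    W₀ = ∏ (suc n) (w zero)
    Wc = ∏ n (λ i → w (suc i) zero)
    Lu = ∏< n (λ i j → u (suc i) - u (suc j))
    Lv = ∏< n (λ i j → v (suc j) - v (suc i))
    W′ = ∏ n (λ i → ∏ n (λ j → w (suc i) (suc j)))
    regroup : ∀ a b c d x y z → a * (b * (c * (d * ((x * y) * z)))) ≈ ((a * x) * (d * y)) * (b * (c * z))
    regroup = solve 7 (λ a b c d x y z →
      a :* (b :* (c :* (d :* ((x :* y) :* z)))) := ((a :* x) :* (d :* y)) :* (b :* (c :* z))) refl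

  det-opposite-shifts : ∀ n (A : Matrix n) →
    det n (λ i j → A i j + 1# * 1#) + det n (λ i j → A i j + - 1# * 1#) ≈ det n A + det n A
  det-opposite-shifts n A = begin
    det n (λ i j → A i j + 1# * 1#) + det n (λ i j → A i j + - 1# * 1#)
      ≈⟨ +-cong (det-rank-one-update n A (λ _ → 1#) (λ _ → 1#))
                (det-rank-one-update n A (λ _ → - 1#) (λ _ → 1#)) ⟩
    (det n A + ∑ n (λ r → 1# * X r)) + (det n A + ∑ n (λ r → - 1# * X r))
      ≈⟨ +-cong (+-congˡ (*-distribˡ-∑ n 1# X)) (+-congˡ (*-distribˡ-∑ n (- 1#) X)) ⟨
    (det n A + 1# * ∑ n X) + (det n A + - 1# * ∑ n X)
      ≈⟨ cancel (det n A) (∑ n X) ⟩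
    det n A + det n A ∎
    where
    X : Fin n → Carrier
    X r = det n (A [ r ]≔ λ _ → 1#)
    cancel : ∀ d s → (d + 1# * s) + (d + - 1# * s) ≈ d + d
    cancel = solve 2 (λ d s → (d :+ con (+ 1) :* s) :+ (d :+ :- con (+ 1) :* s) := d :+ d) refl

  half-double : (two≉0 : ¬ ((1# + 1#) ≈ 0#)) → ∀ y → inv (1# + 1#) two≉0 * (y + y) ≈ y
  half-double two≉0 y = begin
    ½ * (y + y)          ≈⟨ *-congˡ (double y) ⟩
    ½ * ((1# + 1#) * y)  ≈⟨ *-assoc _ _ _ ⟨
    (½ * (1# + 1#)) * y  ≈⟨ *-congʳ (trans (*-comm _ _) (inverse _ two≉0)) ⟩
    1# * y               ≈⟨ *-identityˡ y ⟩
    y                    ∎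
    where
    ½ = inv (1# + 1#) two≉0
    double : ∀ y → y + y ≈ (1# + 1#) * y
    double = solve 1 (λ y → y :+ y := (con (+ 1) :+ con (+ 1)) :* y) refl

  shifted-entry⁺ : ∀ {a b x} → (1# + a * b) * x ≈ 1# → (a + b) * x + 1# * 1# ≈ (1# + a) * (x * (1# + b))
  shifted-entry⁺ {a} {b} {x} px≈1 = trans (+-congˡ (trans (*-identityˡ 1#) (sym px≈1))) (factor a b x)
    where
    factor : ∀ a b x → (a + b) * x + (1# + a * b) * x ≈ (1# + a) * (x * (1# + b))
    factor = solve 3 (λ a b x →
      (a :+ b) :* x :+ (con (+ 1) :+ a :* b) :* x := (con (+ 1) :+ a) :* (x :* (con (+ 1) :+ b))) refl

  shifted-entry⁻ : ∀ {a b x} → (1# + a * b) * x ≈ 1# → (a + b) * x + - 1# * 1# ≈ - (1# - a) * (x * (1# - b))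
  shifted-entry⁻ {a} {b} {x} px≈1 = trans (+-congˡ (*-congˡ (sym px≈1))) (factor a b x)
    where
    factor : ∀ a b x → (a + b) * x + - 1# * ((1# + a * b) * x) ≈ - (1# - a) * (x * (1# - b))
    factor = solve 3 (λ a b x →
      (a :+ b) :* x :+ :- con (+ 1) :* ((con (+ 1) :+ a :* b) :* x)
        := :- (con (+ 1) :- a) :* (x :* (con (+ 1) :- b))) refl

theorem3 : ∀ {c ℓ} (F : Field c ℓ) →
    let open Field F in
    let open FieldOps F in
    (two≉0 : ¬ ((1# + 1#) ≈ 0#)) →
    (m : ℕ) → 1 ≤ m →
    (u v : Fin m → Carrier) →
    (h : ∀ i j → ¬ ((1# + u i * v j) ≈ 0#)) →
    det m (λ i j → (u i + v j) * inv (1# + u i * v j) (h i j))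
      ≈ (((inv (1# + 1#) two≉0
            * ((∏ m (λ i → 1# + u i) * ∏ m (λ j → 1# + v j))
               + (sgn m * (∏ m (λ i → 1# - u i) * ∏ m (λ j → 1# - v j)))))
          * ∏< m (λ i j → u i - u j))
         * ∏< m (λ i j → v j - v i))
        * ∏ m (λ i → ∏ m (λ j → inv (1# + u i * v j) (h i j)))
theorem3 F two≉0 m _ u v h = begin
  det m M
    ≈⟨ half-double two≉0 (det m M) ⟨
  ½ * (det m M + det m M)
    ≈⟨ *-congˡ (det-opposite-shifts m M) ⟨
  ½ * (det m (λ i j → M i j + 1# * 1#) + det m (λ i j → M i j + - 1# * 1#))
    ≈⟨ *-congˡ (+-cong (trans (det-cong m (λ i j → shifted-entry⁺ (w-inverse i j))) (det-scale m _ _ w))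
                       (trans (det-cong m (λ i j → shifted-entry⁻ (w-inverse i j))) (det-scale m _ _ w))) ⟩
  ½ * (U⁺ * (V⁺ * det m w) + ∏ m (λ i → - (1# - u i)) * (V⁻ * det m w))
    ≈⟨ *-congˡ (+-congˡ (*-congʳ (∏-neg m (λ i → 1# - u i)))) ⟩
  ½ * (U⁺ * (V⁺ * det m w) + (sgn m * U⁻) * (V⁻ * det m w))
    ≈⟨ *-congˡ (+-cong (*-congˡ (*-congˡ (cauchy-det m u v h))) (*-congˡ (*-congˡ (cauchy-det m u v h)))) ⟩
  ½ * (U⁺ * (V⁺ * ((L * R) * W)) + (sgn m * U⁻) * (V⁻ * ((L * R) * W)))
    ≈⟨ collect ½ U⁺ V⁺ (sgn m) U⁻ V⁻ L R W ⟩
  (((½ * ((U⁺ * V⁺) + (sgn m * (U⁻ * V⁻)))) * L) * R) * W ∎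
  where
  open Field F
  open FieldOps F
  open Determinant F
  open ℤ-RingSolver commutativeRing using (solve; _:+_; _:*_; _:=_)
  open import Relation.Binary.Reasoning.Setoid setoid
  w = cauchyMatrix u v h
  M : Matrix m
  M i j = (u i + v j) * w i j
  w-inverse : ∀ i j → (1# + u i * v j) * w i j ≈ 1#
  w-inverse i j = inverse _ (h i j)
  ½ = inv (1# + 1#) two≉0
  U⁺ = ∏ m (λ i → 1# + u i)
  V⁺ = ∏ m (λ j → 1# + v j)
  U⁻ = ∏ m (λ i → 1# - u i)
  V⁻ = ∏ m (λ j → 1# - v j)
  L = ∏< m (λ i j → u i - u j)
  R = ∏< m (λ i j → v j - v i)
  W = ∏ m (λ i → ∏ m (w i))
  collect : ∀ t a b s c d l r q →
    t * (a * (b * ((l * r) * q)) + (s * c) * (d * ((l * r) * q))) ≈ (((t * ((a * b) + (s * (c * d)))) * l) * r) * q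
  collect = solve 9 (λ t a b s c d l r q →
    t :* (a :* (b :* ((l :* r) :* q)) :+ (s :* c) :* (d :* ((l :* r) :* q)))
      := (((t :* ((a :* b) :+ (s :* (c :* d)))) :* l) :* r) :* q) refl
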